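{- For each $n\ge 1$, consider $F$ as a permutation of $\mathcal{C}_n$. Then: (i) all $F$-orbits (cycles) on $\mathcal{C}_n$ have the same length, and this length is a power of $2$; (ii) all $F$-orbits on $\mathcal{C}_n$ have the same parity; (iii) the common length is $1$ for $n=1$ and is $2^{k}$ for $n\ge 2$, where $k$ is the number of binary digits of $n-2$ (so $k=0$ for $n=2$); the common parity is $1$ if $n=1$ or $n=2^{j}+1$ for some integer $j\ge 1$, and is $0$ for all other $n\ge 2$.
   Context: Dyck paths are words in $U$ (upstep) and $D$ (downstep) with equally many of each such that every prefix has at least as many $U$'s as $D$'s; size = number of $U$'s; $\epsilon$ = empty path; powers denote repetition. A nonempty Dyck path is primitive if no nonempty proper prefix is a Dyck path; every nonempty Dyck path is uniquely a concatenation of primitive ones (its components). The bijection $F$ on Dyck paths: $F(\epsilon)=\epsilon$; if $P$ has components $P_1,\dots,P_r$, $r\ge2$, then $F(P)=F(P_1)\cdots F(P_r)$; a primitive $P$ is uniquely $P=UQ(UD)^iD$ with $i\ge0$ and $Q$ a Dyck path that is empty or ends with $DD$, and $F(P)=U^{i+1}F(R)UDD^{i+1}$ if $Q$ is primitive, $Q=URD$, while $F(P)=U^{i+1}F(Q)D^{i+1}$ if $Q$ is not primitive (including $Q=\epsilon$). The height of a vertex is its height above the starting level; the height of a path is the maximum vertex height. A Dyck path avoids $DUU$ if it has no three consecutive steps $D,U,U$. To a $DUU$-avoiding Dyck $n$-path of height $h$ associate the composition $(c_1,\dots,c_h)$ of $n$ where $c_i$ is the number of downsteps ending at height $h-i$;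 this is a bijection between $DUU$-avoiding Dyck $n$-paths and compositions of $n$, and primitive such paths correspond to compositions whose last entry is $1$. $F$ maps primitive $DUU$-avoiding Dyck $n$-paths to primitive $DUU$-avoiding Dyck $n$-paths, hence induces a permutation, also denoted $F$, of the set $\mathcal{C}_n$ of compositions of $n$ with last entry $1$. The parity of a composition is the parity of its number of entries (1 if odd, 0 if even), and the parity of an $F$-orbit is the sum mod $2$ of the parities of the compositions in it. -}

module Defs where

open import Data.Nat using (ℕ; zero; suc; _+_; _∸_; _^_; _≟_; _⊔_; ⌊_/2⌋)
open import Data.List using (List; []; _∷_; _++_; length; reverse; replicate; concatMap; map; upTo; filter)
open import Data.Product using (_×_; _,_; ∃; ∃-syntax)
open import Relation.Binary.PropositionalEquality using (_≡_)
open import Relation.Nullary using (¬_)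

data Step : Set where
  U D : Step

Path : Set
Path = List Step

data DyckFrom : ℕ → Path → Set where
  done : DyckFrom 0 []
  up   : ∀ {h xs} → DyckFrom (suc h) xs → DyckFrom h (U ∷ xs)
  down : ∀ {h xs} → DyckFrom h xs → DyckFrom (suc h) (D ∷ xs)

Dyck : Path → Set
Dyck p = DyckFrom 0 p

size : Path → ℕ
size []       = 0
size (U ∷ xs) = suc (size xs)
size (D ∷ xs) = size xs

Primitive : Path → Set
Primitive p = ¬ (p ≡ []) ×
  (∀ a b → a ++ b ≡ p → ¬ (a ≡ []) → ¬ (b ≡ []) → ¬ Dyck a)

AvoidsDUU : Path → Set
AvoidsDUU p = ¬ (∃[ a ] ∃[ b ] (p ≡ a ++ (D ∷ U ∷ U ∷ b)))

-- split h p : splits off the prefix of p up to the first return to level 0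
-- (p read as starting at height h)
splitComp : ℕ → Path → Path × Path
splitComp h [] = [] , []
splitComp h (U ∷ xs) with splitComp (suc h) xs
... | a , b = U ∷ a , b
splitComp zero (D ∷ xs) = [] , D ∷ xs
splitComp (suc zero) (D ∷ xs) = D ∷ [] , xs
splitComp (suc (suc h)) (D ∷ xs) with splitComp (suc h) xs
... | a , b = D ∷ a , b

compsFuel : ℕ → Path → List Path
compsFuel zero    _  = []
compsFuel (suc f) [] = []
compsFuel (suc f) p with splitComp 0 p
... | [] , _ = []
... | a ∷ as , b = (a ∷ as) ∷ compsFuel f b

components : Path → List Path
components p = compsFuel (length p) p

-- for P = U X D, body P = X
body : Path → Path
body []       = []
body (s ∷ xs) with reverse xs
... | []     = []
... | _ ∷ r  = reverse r

-- reversed path: strips leading (reversed) copies of UD, i.e. "D U"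
stripRevUD : Path → ℕ × Path
stripRevUD (D ∷ U ∷ xs) with stripRevUD xs
... | i , q = suc i , q
stripRevUD xs = 0 , xs

data PrimCase : Set where
  primQ nonPrimQ : PrimCase

primCase : Path → PrimCase
primCase q with components q
... | _ ∷ [] = primQ
... | _      = nonPrimQ

FFuel : ℕ → Path → Path
FFuel zero    _  = []
FFuel (suc f) [] = []
FFuel (suc f) p with components p
... | []          = []
... | c ∷ d ∷ cs  = concatMap (FFuel f) (c ∷ d ∷ cs)
... | P ∷ []      with stripRevUD (reverse (body P))
...   | i , rq    with reverse rq
...     | Q       with primCase Q
...       | primQ    = replicate (suc i) U ++ FFuel f (body Q) ++ (U ∷ D ∷ replicate (suc i) D)
...       | nonPrimQ = replicate (suc i) U ++ FFuel f Q ++ replicate (suc i) D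

F : Path → Path
F p = FFuel (length p) p

F^ : ℕ → Path → Path
F^ zero    p = p
F^ (suc m) p = F (F^ m p)

vertexHeights : ℕ → Path → List ℕ
vertexHeights h []       = h ∷ []
vertexHeights h (U ∷ xs) = h ∷ vertexHeights (suc h) xs
vertexHeights h (D ∷ xs) = h ∷ vertexHeights (h ∸ 1) xs

maxList : List ℕ → ℕ
maxList []       = 0
maxList (x ∷ xs) = x ⊔ maxList xs

height : Path → ℕ
height p = maxList (vertexHeights 0 p)

downEnds : ℕ → Path → List ℕ
downEnds h []       = []
downEnds h (U ∷ xs) = downEnds (suc h) xs
downEnds h (D ∷ xs) = (h ∸ 1) ∷ downEnds (h ∸ 1) xs

count : ℕ → List ℕ → ℕ
count k xs = length (filter (_≟ k) xs)

-- (c_1, …, c_h) with c_i = number of downsteps ending at height h - i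
composition : Path → List ℕ
composition p = map (λ j → count (height p ∸ suc j) (downEnds 0 p)) (upTo (height p))

parity : List ℕ → ℕ
parity c = length c Data.Nat.% 2
  where import Data.Nat

-- number of binary digits (bits 0 = 0)
bitsFuel : ℕ → ℕ → ℕ
bitsFuel zero    _ = 0
bitsFuel (suc f) zero = 0
bitsFuel (suc f) (suc m) = suc (bitsFuel f ⌊ suc m /2⌋)

binaryDigits : ℕ → ℕ
binaryDigits m = bitsFuel m m

orbitLength : ℕ → ℕ
orbitLength zero          = 1
orbitLength (suc zero)    = 1
orbitLength (suc (suc m)) = 2 ^ binaryDigits m

orbitParitySum : ℕ → Path → ℕ
orbitParitySum zero    p = 0
orbitParitySum (suc L) p = orbitParitySum L p + parity (composition (F^ L p))

-- Every primitive DUU-avoiding Dyck path is a tower U (tower r) (UD)ˣ D, indexed by a list r of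
-- naturals, and F maps towers to towers. Encoding x₁ ∷ x₂ ∷ … as the word 1 0^x₁ 1 0^x₂ … of length
-- n − 1 over GF(2), F becomes prefix summation: division by 1 + x of the word read as a truncated
-- power series. Since (1 + x)^(2ʲ) = 1 + x^(2ʲ), the 2ʲ-th iterate fixes the first 2ʲ letters, so
-- every orbit has length L, the least power of two above n − 2; for 0 < t = o·2ʲ < L with o odd,
-- the t-th iterate flips the letter at 2ʲ ≤ n − 2. The parity of a composition is that of its
-- height 1 + length r, i.e. of 1 plus the number of 1s of the word, which is the last letter of
-- the next word. Summing over an orbit leaves L plus the coefficient of x^(n−2) in
-- Σ_{t<L} (1 + x)^(−t) v, and this coefficient is 1 exactly when n − 1 = L.

module Submission where

open import Defs
open import Data.Nat using (ℕ; zero; suc; _+_; _^_; _≤_; _<_; _%_)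
open import Data.Product using (_×_; ∃-syntax)
open import Data.Sum using (_⊎_)
open import Relation.Binary.PropositionalEquality using (_≡_)
open import Relation.Nullary using (¬_)
open import Function.Bundles using (_⇔_)

open import Data.Nat.Base using (_*_; _∸_; _⊔_; s≤s; z≤n; ⌊_/2⌋; NonZero)
import Data.Nat.Base as ℕ
open import Data.Nat.Properties
open import Data.Nat.DivMod using ([m+n]%n≡m%n)
open import Data.Nat.GeneralisedArithmetic using (fold; fold-+)
open import Data.Nat.Induction using (<-rec)
open import Data.Nat.ListAction using (sum)
open import Data.Parity.Base using (Parity; 0ℙ; 1ℙ; _⁻¹) renaming (_+_ to infixl 6 _⊕_; _*_ to infixl 7 _⊗_)
import Data.Parity.Properties as ℙ
open import Algebra.Properties.CommutativeSemigroup ℙ.+-commutativeSemigroup using (interchange; xy∙z≈xz∙y)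
open import Data.List.Base using (List; []; _∷_; _++_; length; replicate; reverse; concatMap; foldr; map; upTo)
open import Data.List.Properties
  using (++-assoc; ++-identityʳ; length-++; length-replicate; length-map; length-upTo;
         reverse-++; reverse-involutive; unfold-reverse; ∷-injectiveʳ)
open import Data.List.Relation.Unary.All using (All; []; _∷_)
open import Data.List.Relation.Unary.Any using (Any; here; there)
open import Data.Product using (_,_; proj₁; proj₂)
open import Data.Product.Properties using (,-injective)
open import Data.Sum using (inj₁; inj₂)
open import Function.Bundles using (mk⇔)
open import Function.Construct.Composition using (_⇔-∘_)
open import Relation.Binary.Definitions using (tri<; tri≈; tri>)
open import Relation.Binary.PropositionalEquality using (refl; sym; trans; cong; cong₂; subst; module ≡-Reasoning)
open import Relation.Nullary using (yes; no; contradiction)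

-- Binary digits and parities

toℕ : Parity → ℕ
toℕ 0ℙ = 0
toℕ 1ℙ = 1

parity-toℕ : ∀ p → ℕ.parity (toℕ p) ≡ p
parity-toℕ 0ℙ = refl
parity-toℕ 1ℙ = refl

%2≡toℕ∘parity : ∀ n → n % 2 ≡ toℕ (ℕ.parity n)
%2≡toℕ∘parity zero          = refl
%2≡toℕ∘parity (suc zero)    = refl
%2≡toℕ∘parity (suc (suc n)) = trans (cong (_% 2) (+-comm 2 n)) (trans ([m+n]%n≡m%n n 2) (%2≡toℕ∘parity n))

parity-%2 : ∀ n → ℕ.parity (n % 2) ≡ ℕ.parity n
parity-%2 n = trans (cong ℕ.parity (%2≡toℕ∘parity n)) (parity-toℕ (ℕ.parity n))

2^[1+b]≡2^b+2^b : ∀ b → 2 ^ suc b ≡ 2 ^ b + 2 ^ b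
2^[1+b]≡2^b+2^b b = cong (2 ^ b +_) (+-identityʳ (2 ^ b))

⌊n/2⌋-bounds : ∀ n → ⌊ n /2⌋ + ⌊ n /2⌋ ≤ n × n ≤ suc (⌊ n /2⌋ + ⌊ n /2⌋)
⌊n/2⌋-bounds zero          = z≤n , z≤n
⌊n/2⌋-bounds (suc zero)    = z≤n , ≤-refl
⌊n/2⌋-bounds (suc (suc n)) with ⌊n/2⌋-bounds n
... | lower , upper rewrite +-suc ⌊ n /2⌋ ⌊ n /2⌋ = s≤s (s≤s lower) , s≤s (s≤s upper)

bitsFuel-0 : ∀ f → bitsFuel f 0 ≡ 0
bitsFuel-0 zero    = refl
bitsFuel-0 (suc f) = refl

bitsFuel-spec : ∀ f m → 1 ≤ m → m ≤ f → ∃[ b ] (bitsFuel f m ≡ suc b × 2 ^ b ≤ m × m < 2 ^ suc b)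
bitsFuel-spec (suc f) (suc zero)    _ _ = 0 , cong suc (bitsFuel-0 f) , ≤-refl , s≤s (s≤s z≤n)
bitsFuel-spec (suc f) (suc (suc m)) _ m≤f
  with bitsFuel-spec f ⌊ suc (suc m) /2⌋ (s≤s z≤n) (≤-trans (≤-pred (⌊n/2⌋<n (suc m))) (≤-pred m≤f))
... | b , bits≡ , 2^b≤h , h<2^[1+b] = suc b , cong suc bits≡ , lower , upper
  where
  h = ⌊ suc (suc m) /2⌋
  open ≤-Reasoning
  lower : 2 ^ suc b ≤ suc (suc m)
  lower = begin
    2 ^ suc b     ≡⟨ 2^[1+b]≡2^b+2^b b ⟩
    2 ^ b + 2 ^ b ≤⟨ +-mono-≤ 2^b≤h 2^b≤h ⟩
    h + h         ≤⟨ proj₁ (⌊n/2⌋-bounds (suc (suc m))) ⟩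
    suc (suc m)   ∎
  upper : suc (suc m) < 2 ^ suc (suc b)
  upper = begin-strict
    suc (suc m)           ≤⟨ proj₂ (⌊n/2⌋-bounds (suc (suc m))) ⟩
    suc (h + h)           <⟨ n<1+n (suc (h + h)) ⟩
    suc (suc (h + h))     ≡⟨ cong suc (+-suc h h) ⟨
    suc h + suc h         ≤⟨ +-mono-≤ h<2^[1+b] h<2^[1+b] ⟩
    2 ^ suc b + 2 ^ suc b ≡⟨ 2^[1+b]≡2^b+2^b (suc b) ⟨
    2 ^ suc (suc b)       ∎

binaryDigits-spec : ∀ m → 1 ≤ m → ∃[ b ] (binaryDigits m ≡ suc b × 2 ^ b ≤ m × m < 2 ^ suc b)
binaryDigits-spec m 1≤m = bitsFuel-spec m m 1≤m ≤-refl

<2^binaryDigits : ∀ m → m < 2 ^ binaryDigits m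
<2^binaryDigits zero    = s≤s z≤n
<2^binaryDigits (suc m) with binaryDigits-spec (suc m) (s≤s z≤n)
... | b , bits≡ , _ , upper = subst (λ k → suc m < 2 ^ k) (sym bits≡) upper

^-cancelʳ-< : ∀ m .{{_ : NonZero m}} j k → m ^ j < m ^ k → j < k
^-cancelʳ-< m j k m^j<m^k with j <? k
... | yes j<k = j<k
... | no  j≮k = contradiction (^-monoʳ-≤ m (≮⇒≥ j≮k)) (<⇒≱ m^j<m^k)

binaryDigits-pred-2^ : ∀ m j → 1 ≤ m → suc m ≡ 2 ^ j → binaryDigits m ≡ j
binaryDigits-pred-2^ m j 1≤m 1+m≡2^j with binaryDigits-spec m 1≤m
... | b , bits≡ , 2^b≤m , m<2^[1+b] = trans bits≡ (≤-antisym 1+b≤j j≤1+b)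
  where
  1+b≤j : suc b ≤ j
  1+b≤j = ^-cancelʳ-< 2 b j (subst (2 ^ b <_) 1+m≡2^j (s≤s 2^b≤m))
  j≤1+b : j ≤ suc b
  j≤1+b = ≤-pred (^-cancelʳ-< 2 j (suc (suc b))
    (≤-<-trans (subst (_≤ 2 ^ suc b) 1+m≡2^j m<2^[1+b]) (^-monoʳ-< 2 (s≤s (s≤s z≤n)) (n<1+n (suc b)))))

%2≡1⇔parity≡1ℙ : ∀ x → x % 2 ≡ 1 ⇔ ℕ.parity x ≡ 1ℙ
%2≡1⇔parity≡1ℙ x rewrite %2≡toℕ∘parity x with ℕ.parity x
... | 0ℙ = mk⇔ (λ ()) (λ ())
... | 1ℙ = mk⇔ (λ _ → refl) (λ _ → refl)

parity-2^suc : ∀ b → ℕ.parity (2 ^ suc b) ≡ 0ℙ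
parity-2^suc b = ℙ.*-homo-* 2 (2 ^ b)

-- Power series over GF(2)

x⊕y⊕y≡x : ∀ x y → x ⊕ y ⊕ y ≡ x
x⊕y⊕y≡x x y = trans (ℙ.+-assoc x y y) (trans (cong (x ⊕_) (ℙ.p+p≡0ℙ y)) (ℙ.+-identityʳ x))

x⊕[x⊕y]≡y : ∀ x y → x ⊕ (x ⊕ y) ≡ y
x⊕[x⊕y]≡y x y = trans (sym (ℙ.+-assoc x x y)) (cong (_⊕ y) (ℙ.p+p≡0ℙ x))

-- A series v is the power series Σ v i xⁱ over GF(2); prefixSum divides it by 1 + x.
Series : Set
Series = ℕ → Parity

prefixSum : Series → Series
prefixSum v zero    = v zero
prefixSum v (suc i) = prefixSum v i ⊕ v (suc i)

prefixSum-cong≤ : ∀ u w i → (∀ k → k ≤ i → u k ≡ w k) → prefixSum u i ≡ prefixSum w i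
prefixSum-cong≤ u w zero    agree = agree 0 z≤n
prefixSum-cong≤ u w (suc i) agree =
  cong₂ _⊕_ (prefixSum-cong≤ u w i (λ k k≤i → agree k (m≤n⇒m≤1+n k≤i))) (agree (suc i) ≤-refl)

prefixSum^ : ℕ → Series → Series
prefixSum^ t v = fold v prefixSum t

-- Quotient1+x^ s v w says w = v / (1 + xˢ), i.e. w = v + xˢ w.
Quotient1+x^ : ℕ → Series → Series → Set
Quotient1+x^ s v w = (∀ i → i < s → w i ≡ v i) × (∀ i → w (s + i) ≡ v (s + i) ⊕ w i)

prefixSum-quotient : ∀ v → Quotient1+x^ 1 v (prefixSum v)
prefixSum-quotient v = (λ { zero _ → refl ; (suc _) (s≤s ()) }) , λ i → ℙ.+-comm (prefixSum v i) (v (suc i))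

-- (1 + xˢ)² = 1 + x²ˢ in characteristic 2.
quotient-square : ∀ {s v w u} → Quotient1+x^ s v w → Quotient1+x^ s w u → Quotient1+x^ (s + s) v u
quotient-square {s} {v} {w} {u} (w-low , w-rec) (u-low , u-rec) = low , rec
  where
  high-part : ∀ j → j < s → u (s + j) ≡ v (s + j)
  high-part j j<s = begin
    u (s + j)               ≡⟨ u-rec j ⟩
    w (s + j) ⊕ u j         ≡⟨ cong₂ _⊕_ (w-rec j) (u-low j j<s) ⟩
    v (s + j) ⊕ w j ⊕ w j   ≡⟨ x⊕y⊕y≡x _ _ ⟩
    v (s + j)               ∎
    where open ≡-Reasoning
  low : ∀ i → i < s + s → u i ≡ v i
  low i i<2s with i <? s
  ... | yes i<s = trans (u-low i i<s) (w-low i i<s)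
  ... | no i≮s with m≤n⇒∃[o]m+o≡n (≮⇒≥ i≮s)
  ...   | j , refl = high-part j (+-cancelˡ-< s j s i<2s)
  rec : ∀ i → u (s + s + i) ≡ v (s + s + i) ⊕ u i
  rec i rewrite +-assoc s s i = begin
    u (s + (s + i))                  ≡⟨ u-rec (s + i) ⟩
    w (s + (s + i)) ⊕ u (s + i)      ≡⟨ cong₂ _⊕_ (w-rec (s + i)) (u-rec i) ⟩
    v (s + (s + i)) ⊕ b ⊕ (b ⊕ u i)  ≡⟨ ℙ.+-assoc (v (s + (s + i))) b (b ⊕ u i) ⟩
    v (s + (s + i)) ⊕ (b ⊕ (b ⊕ u i)) ≡⟨ cong (v (s + (s + i)) ⊕_) (x⊕[x⊕y]≡y b (u i)) ⟩
    v (s + (s + i)) ⊕ u i            ∎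
    where
    open ≡-Reasoning
    b = w (s + i)

prefixSum^-+ : ∀ a b v → prefixSum^ (a + b) v ≡ prefixSum^ a (prefixSum^ b v)
prefixSum^-+ a b v = fold-+ v prefixSum a

prefixSum^-2^ : ∀ j v → Quotient1+x^ (2 ^ j) v (prefixSum^ (2 ^ j) v)
prefixSum^-2^ zero v = prefixSum-quotient v
prefixSum^-2^ (suc j) v = subst (λ t → Quotient1+x^ t v (prefixSum^ t v)) (sym (2^[1+b]≡2^b+2^b j))
  (subst (Quotient1+x^ (s + s) v) (sym (prefixSum^-+ s s v))
    (quotient-square (prefixSum^-2^ j v) (prefixSum^-2^ j (prefixSum^ s v))))
  where
  s = 2 ^ j

quotient-at-0-and-s : ∀ {s v w} → 1 ≤ s → Quotient1+x^ s v w → w 0 ≡ v 0 × w s ≡ v s ⊕ v 0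
quotient-at-0-and-s {s} {v} {w} 1≤s (low , rec) = low 0 1≤s , (begin
  w s           ≡⟨ cong w (sym (+-identityʳ s)) ⟩
  w (s + 0)     ≡⟨ rec 0 ⟩
  v (s + 0) ⊕ w 0 ≡⟨ cong₂ _⊕_ (cong v (+-identityʳ s)) (low 0 1≤s) ⟩
  v s ⊕ v 0     ∎)
  where open ≡-Reasoning

prefixSum^-*2^ : ∀ j o v → prefixSum^ (o * 2 ^ j) v 0 ≡ v 0
                         × prefixSum^ (o * 2 ^ j) v (2 ^ j) ≡ v (2 ^ j) ⊕ ℕ.parity o ⊗ v 0
prefixSum^-*2^ j zero v = refl , sym (ℙ.+-identityʳ (v (2 ^ j)))
prefixSum^-*2^ j (suc o) v = trans (at split 0) (trans (proj₁ step) (proj₁ IH)) , (begin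
  prefixSum^ (s + o * s) v s      ≡⟨ at split s ⟩
  prefixSum^ s u s                ≡⟨ proj₂ step ⟩
  u s ⊕ u 0                       ≡⟨ cong₂ _⊕_ (proj₂ IH) (proj₁ IH) ⟩
  v s ⊕ ℕ.parity o ⊗ v 0 ⊕ v 0      ≡⟨ ℙ.+-assoc (v s) (ℕ.parity o ⊗ v 0) (v 0) ⟩
  v s ⊕ (ℕ.parity o ⊗ v 0 ⊕ v 0)    ≡⟨ cong (v s ⊕_) (ℙ.+-comm (ℕ.parity o ⊗ v 0) (v 0)) ⟩
  v s ⊕ (v 0 ⊕ ℕ.parity o ⊗ v 0)    ≡⟨ cong (v s ⊕_) (sym (ℙ.*-distribʳ-+ (v 0) 1ℙ (ℕ.parity o))) ⟩
  v s ⊕ (1ℙ ⊕ ℕ.parity o) ⊗ v 0     ≡⟨ cong (λ p → v s ⊕ p ⊗ v 0) (sym (ℙ.+-homo-+ 1 o)) ⟩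
  v s ⊕ ℕ.parity (suc o) ⊗ v 0      ∎)
  where
  open ≡-Reasoning
  s = 2 ^ j
  u = prefixSum^ (o * s) v
  IH = prefixSum^-*2^ j o v
  step = quotient-at-0-and-s (m^n>0 2 j) (prefixSum^-2^ j u)
  split : prefixSum^ (s + o * s) v ≡ prefixSum^ s u
  split = prefixSum^-+ s (o * s) v
  at : ∀ {w w′ : Series} → w ≡ w′ → ∀ i → w i ≡ w′ i
  at refl i = refl

even⇒*2 : ∀ t → ℕ.parity t ≡ 0ℙ → ∃[ h ] t ≡ h * 2
even⇒*2 zero          _ = 0 , refl
even⇒*2 (suc (suc t)) e = let h , t≡h*2 = even⇒*2 t e in suc h , cong (2 +_) t≡h*2

odd*2^-decomposition : ∀ t → 1 ≤ t → ∃[ j ] ∃[ o ] (t ≡ o * 2 ^ j × ℕ.parity o ≡ 1ℙ)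
odd*2^-decomposition = <-rec _ decompose
  where
  decompose : ∀ t → (∀ {t′} → t′ < t → 1 ≤ t′ → ∃[ j ] ∃[ o ] (t′ ≡ o * 2 ^ j × ℕ.parity o ≡ 1ℙ))
            → 1 ≤ t → ∃[ j ] ∃[ o ] (t ≡ o * 2 ^ j × ℕ.parity o ≡ 1ℙ)
  decompose t rec 1≤t with ℕ.parity t in eq
  ... | 1ℙ = 0 , t , sym (*-identityʳ t) , eq
  ... | 0ℙ with even⇒*2 t eq
  ...   | zero  , refl = contradiction 1≤t λ ()
  ...   | suc h , refl with rec (m<m*n (suc h) 2 ≤-refl) (s≤s z≤n)
  ...     | j , o , h≡o*2^j , odd = suc j , o , (begin
    suc h * 2       ≡⟨ cong (_* 2) h≡o*2^j ⟩
    o * 2 ^ j * 2   ≡⟨ *-assoc o (2 ^ j) 2 ⟩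
    o * (2 ^ j * 2) ≡⟨ cong (o *_) (*-comm (2 ^ j) 2) ⟩
    o * 2 ^ suc j   ∎) , odd
    where open ≡-Reasoning

sumOfIterates : ℕ → Series → Series
sumOfIterates zero    v i = 0ℙ
sumOfIterates (suc L) v i = sumOfIterates L v i ⊕ prefixSum^ L v i

prefixSum-⊕ : ∀ a b i → prefixSum (λ k → a k ⊕ b k) i ≡ prefixSum a i ⊕ prefixSum b i
prefixSum-⊕ a b zero    = refl
prefixSum-⊕ a b (suc i) = trans (cong (_⊕ (a (suc i) ⊕ b (suc i))) (prefixSum-⊕ a b i))
  (interchange (prefixSum a i) (prefixSum b i) (a (suc i)) (b (suc i)))

prefixSum-0ℙ : ∀ i → prefixSum (λ _ → 0ℙ) i ≡ 0ℙ
prefixSum-0ℙ zero    = refl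
prefixSum-0ℙ (suc i) = trans (ℙ.+-identityʳ _) (prefixSum-0ℙ i)

prefixSum-sumOfIterates : ∀ L v i →
  prefixSum (sumOfIterates L v) i ≡ sumOfIterates L v i ⊕ prefixSum^ L v i ⊕ v i
prefixSum-sumOfIterates zero    v i = trans (prefixSum-0ℙ i) (sym (ℙ.p+p≡0ℙ (v i)))
prefixSum-sumOfIterates (suc L) v i = begin
  prefixSum (sumOfIterates (suc L) v) i           ≡⟨ prefixSum-⊕ (sumOfIterates L v) (prefixSum^ L v) i ⟩
  prefixSum (sumOfIterates L v) i ⊕ prefixSum^ (suc L) v i ≡⟨ cong (_⊕ prefixSum^ (suc L) v i) (prefixSum-sumOfIterates L v i) ⟩
  sumOfIterates (suc L) v i ⊕ v i ⊕ prefixSum^ (suc L) v i ≡⟨ xy∙z≈xz∙y (sumOfIterates (suc L) v i) (v i) _ ⟩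
  sumOfIterates (suc L) v i ⊕ prefixSum^ (suc L) v i ⊕ v i ∎
  where open ≡-Reasoning

-- For u = Σ_{t<L} (1 + x)⁻ᵗ v and d = (1 + x)⁻ᴸ v + v one has u / (1 + x) = u + d, hence
-- u i = d i + d (i + 1); and d vanishes below L while d L = v 0.
module SumOfIterates {L v} (1≤L : 1 ≤ L) (quot : Quotient1+x^ L v (prefixSum^ L v)) where

  private
    u : Series
    u = sumOfIterates L v

    d : Series
    d i = prefixSum^ L v i ⊕ v i

    d-low : ∀ i → i < L → d i ≡ 0ℙ
    d-low i i<L = trans (cong (_⊕ v i) (proj₁ quot i i<L)) (ℙ.p+p≡0ℙ (v i))

    d-L : d L ≡ v 0
    d-L = begin
      prefixSum^ L v L ⊕ v L ≡⟨ cong (_⊕ v L) (proj₂ (quotient-at-0-and-s 1≤L quot)) ⟩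
      v L ⊕ v 0 ⊕ v L       ≡⟨ xy∙z≈xz∙y (v L) (v 0) (v L) ⟩
      v L ⊕ v L ⊕ v 0       ≡⟨ cong (_⊕ v 0) (ℙ.p+p≡0ℙ (v L)) ⟩
      v 0                   ∎
      where open ≡-Reasoning

    prefixSum-u : ∀ i → prefixSum u i ≡ d (suc i)
    prefixSum-u i = ℙ.+-cancelʳ-≡ (u (suc i)) (prefixSum u i) (d (suc i)) (begin
      prefixSum u (suc i)                            ≡⟨ prefixSum-sumOfIterates L v (suc i) ⟩
      u (suc i) ⊕ prefixSum^ L v (suc i) ⊕ v (suc i) ≡⟨ ℙ.+-assoc (u (suc i)) _ _ ⟩
      u (suc i) ⊕ d (suc i)                          ≡⟨ ℙ.+-comm (u (suc i)) (d (suc i)) ⟩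
      d (suc i) ⊕ u (suc i)                          ∎)
      where open ≡-Reasoning

    u-suc : ∀ i → u (suc i) ≡ d (suc i) ⊕ d (suc (suc i))
    u-suc i = trans (sym (x⊕[x⊕y]≡y (prefixSum u i) (u (suc i))))
                    (cong₂ _⊕_ (prefixSum-u i) (prefixSum-u (suc i)))

  last-coefficient : ∀ m → suc m ≡ L → u m ≡ v 0
  last-coefficient zero    1≡L   = trans (prefixSum-u 0) (trans (cong d 1≡L) d-L)
  last-coefficient (suc i) 2+i≡L = trans (u-suc i)
    (cong₂ _⊕_ (d-low (suc i) (subst (suc i <_) 2+i≡L ≤-refl)) (trans (cong d 2+i≡L) d-L))

  earlier-coefficient : ∀ m → suc m < L → u m ≡ 0ℙ
  earlier-coefficient zero    1<L = trans (prefixSum-u 0) (d-low 1 1<L)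
  earlier-coefficient (suc i) m<L = trans (u-suc i)
    (cong₂ _⊕_ (d-low (suc i) (<-trans (n<1+n (suc i)) m<L)) (d-low (suc (suc i)) m<L))

n≤odd*n : ∀ o n → ℕ.parity o ≡ 1ℙ → n ≤ o * n
n≤odd*n (suc o) n _ = m≤m+n n (o * n)

prefixSum^-period : ∀ m v i → i ≤ m → prefixSum^ (2 ^ binaryDigits m) v i ≡ v i
prefixSum^-period m v i i≤m = proj₁ (prefixSum^-2^ (binaryDigits m) v) i (≤-<-trans i≤m (<2^binaryDigits m))

-- The witness is the index 2ʲ, where 2ʲ is the largest power of two dividing t.
prefixSum^-aperiodic : ∀ m v → v 0 ≡ 1ℙ → ∀ t → 1 ≤ t → t < 2 ^ binaryDigits m →
                       ∃[ i ] (i ≤ m × ¬ prefixSum^ t v i ≡ v i)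
prefixSum^-aperiodic zero v _ t 1≤t t<1 = contradiction 1≤t (<⇒≱ t<1)
prefixSum^-aperiodic (suc m) v v0≡1 t 1≤t t<L
  with binaryDigits-spec (suc m) (s≤s z≤n) | odd*2^-decomposition t 1≤t
... | b , bits≡ , 2^b≤m , _ | j , o , t≡o*2^j , odd = 2 ^ j , 2^j≤m , flips
  where
  2^j≤t : 2 ^ j ≤ t
  2^j≤t = subst (2 ^ j ≤_) (sym t≡o*2^j) (n≤odd*n o (2 ^ j) odd)
  j≤b : j ≤ b
  j≤b = ≤-pred (^-cancelʳ-< 2 j (suc b) (≤-<-trans 2^j≤t (subst (λ k → t < 2 ^ k) bits≡ t<L)))
  2^j≤m : 2 ^ j ≤ suc m
  2^j≤m = ≤-trans (^-monoʳ-≤ 2 j≤b) 2^b≤m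
  flips : ¬ prefixSum^ t v (2 ^ j) ≡ v (2 ^ j)
  flips e = ℙ.p≢p⁻¹ (v (2 ^ j)) (sym (begin
    v (2 ^ j) ⁻¹                    ≡⟨ ℙ.+-comm 1ℙ (v (2 ^ j)) ⟩
    v (2 ^ j) ⊕ 1ℙ                  ≡⟨ cong₂ (λ p q → v (2 ^ j) ⊕ p ⊗ q) odd v0≡1 ⟨
    v (2 ^ j) ⊕ ℕ.parity o ⊗ v 0      ≡⟨ proj₂ (prefixSum^-*2^ j o v) ⟨
    prefixSum^ (o * 2 ^ j) v (2 ^ j) ≡⟨ cong (λ s → prefixSum^ s v (2 ^ j)) t≡o*2^j ⟨
    prefixSum^ t v (2 ^ j)          ≡⟨ e ⟩
    v (2 ^ j)                       ∎))
    where open ≡-Reasoning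

-- Words

word : List ℕ → List Parity
word []      = []
word (x ∷ r) = 1ℙ ∷ replicate x 0ℙ ++ word r

next : List ℕ → List ℕ
next []          = []
next (x ∷ [])    = replicate (suc x) 0
next (x ∷ y ∷ r) = replicate x 0 ++ suc y ∷ next r

next^ : ℕ → List ℕ → List ℕ
next^ t r = fold r next t

prefixSums : Parity → List Parity → List Parity
prefixSums c []      = []
prefixSums c (p ∷ l) = c ⊕ p ∷ prefixSums (c ⊕ p) l

word-++ : ∀ a b → word (a ++ b) ≡ word a ++ word b
word-++ []      b = refl
word-++ (x ∷ a) b = cong (1ℙ ∷_) (trans (cong (replicate x 0ℙ ++_) (word-++ a b))
                                         (sym (++-assoc (replicate x 0ℙ) (word a) (word b))))

word-replicate-0 : ∀ x → word (replicate x 0) ≡ replicate x 1ℙ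
word-replicate-0 zero    = refl
word-replicate-0 (suc x) = cong (1ℙ ∷_) (word-replicate-0 x)

prefixSums-replicate-0ℙ : ∀ c x l → prefixSums c (replicate x 0ℙ ++ l) ≡ replicate x c ++ prefixSums c l
prefixSums-replicate-0ℙ c zero    l = refl
prefixSums-replicate-0ℙ c (suc x) l = cong₂ _∷_ (ℙ.+-identityʳ c)
  (trans (cong (λ c′ → prefixSums c′ (replicate x 0ℙ ++ l)) (ℙ.+-identityʳ c)) (prefixSums-replicate-0ℙ c x l))

replicate-++-∷ : ∀ {A : Set} (a : A) x l → replicate x a ++ a ∷ l ≡ a ∷ replicate x a ++ l
replicate-++-∷ a zero    l = refl
replicate-++-∷ a (suc x) l = cong (a ∷_) (replicate-++-∷ a x l)

word-next : ∀ r → word (next r) ≡ prefixSums 0ℙ (word r)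
word-next []          = refl
word-next (x ∷ [])    = cong (1ℙ ∷_) (begin
  word (replicate x 0)                 ≡⟨ word-replicate-0 x ⟩
  replicate x 1ℙ                       ≡⟨ ++-identityʳ (replicate x 1ℙ) ⟨
  replicate x 1ℙ ++ []                 ≡⟨ prefixSums-replicate-0ℙ 1ℙ x [] ⟨
  prefixSums 1ℙ (replicate x 0ℙ ++ []) ∎)
  where open ≡-Reasoning
word-next (x ∷ y ∷ r) = begin
  word (replicate x 0 ++ suc y ∷ next r)
    ≡⟨ word-++ (replicate x 0) (suc y ∷ next r) ⟩
  word (replicate x 0) ++ 1ℙ ∷ 0ℙ ∷ replicate y 0ℙ ++ word (next r)
    ≡⟨ cong₂ (λ a b → a ++ 1ℙ ∷ 0ℙ ∷ replicate y 0ℙ ++ b) (word-replicate-0 x) (word-next r) ⟩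
  replicate x 1ℙ ++ 1ℙ ∷ 0ℙ ∷ replicate y 0ℙ ++ prefixSums 0ℙ (word r)
    ≡⟨ replicate-++-∷ 1ℙ x _ ⟩
  1ℙ ∷ replicate x 1ℙ ++ 0ℙ ∷ replicate y 0ℙ ++ prefixSums 0ℙ (word r)
    ≡⟨ cong (λ l → 1ℙ ∷ replicate x 1ℙ ++ 0ℙ ∷ l) (prefixSums-replicate-0ℙ 0ℙ y (word r)) ⟨
  1ℙ ∷ replicate x 1ℙ ++ prefixSums 1ℙ (1ℙ ∷ replicate y 0ℙ ++ word r)
    ≡⟨ cong (1ℙ ∷_) (prefixSums-replicate-0ℙ 1ℙ x _) ⟨
  prefixSums 0ℙ (word (x ∷ y ∷ r))                                  ∎
  where open ≡-Reasoning

zeros-++-word-injective : ∀ x y r s → replicate x 0ℙ ++ word r ≡ replicate y 0ℙ ++ word s → x ≡ y × word r ≡ word s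
zeros-++-word-injective zero    zero    r       s       e = refl , e
zeros-++-word-injective (suc x) (suc y) r       s       e with zeros-++-word-injective x y r s (∷-injectiveʳ e)
... | x≡y , e′ = cong suc x≡y , e′
zeros-++-word-injective zero    (suc y) []      s       ()
zeros-++-word-injective zero    (suc y) (_ ∷ _) s       ()
zeros-++-word-injective (suc x) zero    r       []      ()
zeros-++-word-injective (suc x) zero    r       (_ ∷ _) ()

word-injective : ∀ r s → word r ≡ word s → r ≡ s
word-injective []      []      _ = refl
word-injective (x ∷ r) (y ∷ s) e with zeros-++-word-injective x y r s (∷-injectiveʳ e)
... | x≡y , e′ = cong₂ _∷_ x≡y (word-injective r s e′)

length-word : ∀ r → length (word r) ≡ length r + sum r
length-word []      = refl
length-word (x ∷ r) = cong suc (begin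
  length (replicate x 0ℙ ++ word r) ≡⟨ length-++ (replicate x 0ℙ) ⟩
  length (replicate x 0ℙ) + length (word r) ≡⟨ cong₂ _+_ (length-replicate x) (length-word r) ⟩
  x + (length r + sum r)            ≡⟨ +-assoc x (length r) (sum r) ⟨
  x + length r + sum r              ≡⟨ cong (_+ sum r) (+-comm x (length r)) ⟩
  length r + x + sum r              ≡⟨ +-assoc (length r) x (sum r) ⟩
  length r + (x + sum r)            ∎)
  where open ≡-Reasoning

length-prefixSums : ∀ c l → length (prefixSums c l) ≡ length l
length-prefixSums c []      = refl
length-prefixSums c (p ∷ l) = cong suc (length-prefixSums (c ⊕ p) l)

length-word-next^ : ∀ t r → length (word (next^ t r)) ≡ length (word r)
length-word-next^ zero    r = refl
length-word-next^ (suc t) r = begin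
  length (word (next (next^ t r)))         ≡⟨ cong length (word-next (next^ t r)) ⟩
  length (prefixSums 0ℙ (word (next^ t r))) ≡⟨ length-prefixSums 0ℙ (word (next^ t r)) ⟩
  length (word (next^ t r))                ≡⟨ length-word-next^ t r ⟩
  length (word r)                          ∎
  where open ≡-Reasoning

series : List Parity → Series
series []      i       = 0ℙ
series (p ∷ l) zero    = p
series (p ∷ l) (suc i) = series l i

series-injective : ∀ l l′ → length l ≡ length l′ → (∀ i → i < length l → series l i ≡ series l′ i) → l ≡ l′
series-injective []      []       _ _     = refl
series-injective (p ∷ l) (p′ ∷ l′) e agree =
  cong₂ _∷_ (agree 0 (s≤s z≤n)) (series-injective l l′ (suc-injective e) (λ i i<l → agree (suc i) (s≤s i<l)))

series-prefixSums-suc : ∀ c l i → suc i < length l →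
  series (prefixSums c l) (suc i) ≡ series (prefixSums c l) i ⊕ series l (suc i)
series-prefixSums-suc c (p ∷ q ∷ l) zero    _         = refl
series-prefixSums-suc c (p ∷ l)     (suc i) (s≤s i<l) = series-prefixSums-suc (c ⊕ p) l i i<l

series-prefixSums : ∀ l i → i < length l → series (prefixSums 0ℙ l) i ≡ prefixSum (series l) i
series-prefixSums (p ∷ l) zero    _   = refl
series-prefixSums l       (suc i) i<l = trans (series-prefixSums-suc 0ℙ l i i<l)
  (cong (_⊕ series l (suc i)) (series-prefixSums l i (<-trans (n<1+n i) i<l)))

series-word-next^ : ∀ t r i → i < length (word r) → series (word (next^ t r)) i ≡ prefixSum^ t (series (word r)) i
series-word-next^ zero    r i i<l = refl
series-word-next^ (suc t) r i i<l = begin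
  series (word (next (next^ t r))) i
    ≡⟨ cong (λ l → series l i) (word-next (next^ t r)) ⟩
  series (prefixSums 0ℙ (word (next^ t r))) i
    ≡⟨ series-prefixSums (word (next^ t r)) i (subst (i <_) (sym (length-word-next^ t r)) i<l) ⟩
  prefixSum (series (word (next^ t r))) i
    ≡⟨ prefixSum-cong≤ _ _ i (λ k k≤i → series-word-next^ t r k (≤-<-trans k≤i i<l)) ⟩
  prefixSum (prefixSum^ t (series (word r))) i ∎
  where open ≡-Reasoning

sumℙ : List Parity → Parity
sumℙ = foldr _⊕_ 0ℙ

series-prefixSums-last : ∀ c l m → length l ≡ suc m → series (prefixSums c l) m ≡ c ⊕ sumℙ l
series-prefixSums-last c (p ∷ [])    zero    _ = cong (c ⊕_) (sym (ℙ.+-identityʳ p))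
series-prefixSums-last c (p ∷ q ∷ l) (suc m) e =
  trans (series-prefixSums-last (c ⊕ p) (q ∷ l) m (suc-injective e)) (ℙ.+-assoc c p (sumℙ (q ∷ l)))

sumℙ-zeros-++ : ∀ x l → sumℙ (replicate x 0ℙ ++ l) ≡ sumℙ l
sumℙ-zeros-++ zero    l = refl
sumℙ-zeros-++ (suc x) l = sumℙ-zeros-++ x l

sumℙ-word : ∀ r → sumℙ (word r) ≡ ℕ.parity (length r)
sumℙ-word []      = refl
sumℙ-word (x ∷ r) = trans (cong (1ℙ ⊕_) (trans (sumℙ-zeros-++ x (word r)) (sumℙ-word r)))
                          (sym (ℙ.+-homo-+ 1 (length r)))

series-word-head : ∀ r → 0 < length (word r) → series (word r) 0 ≡ 1ℙ
series-word-head (x ∷ r) _ = refl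

-- Towers

peak : Path
peak = U ∷ D ∷ []

peaks : ℕ → Path
peaks zero    = []
peaks (suc x) = U ∷ D ∷ peaks x

towerBody : List ℕ → Path

tower : List ℕ → Path
tower r = U ∷ towerBody r ++ D ∷ []

towerBody []      = []
towerBody (x ∷ r) = tower r ++ peaks x

data FirstReturn : ℕ → Path → Set where
  ret-up   : ∀ {h a} → FirstReturn (suc h) a → FirstReturn h (U ∷ a)
  ret-last : FirstReturn 1 (D ∷ [])
  ret-down : ∀ {h a} → FirstReturn (suc h) a → FirstReturn (suc (suc h)) (D ∷ a)

splitComp-firstReturn : ∀ {h a} b → FirstReturn h a → splitComp h (a ++ b) ≡ (a , b)
splitComp-firstReturn b (ret-up r)   rewrite splitComp-firstReturn b r = refl
splitComp-firstReturn b ret-last     = refl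
splitComp-firstReturn b (ret-down r) rewrite splitComp-firstReturn b r = refl

data Positive : ℕ → Path → ℕ → Set where
  pos-nil  : ∀ {h} → Positive h [] h
  pos-up   : ∀ {h c h′} → Positive (suc h) c h′ → Positive h (U ∷ c) h′
  pos-down : ∀ {h c h′} → Positive (suc h) c h′ → Positive (suc (suc h)) (D ∷ c) h′

positive-++ : ∀ {h a h′ b h″} → Positive h a h′ → Positive h′ b h″ → Positive h (a ++ b) h″
positive-++ pos-nil      q = q
positive-++ (pos-up p)   q = pos-up (positive-++ p q)
positive-++ (pos-down p) q = pos-down (positive-++ p q)

positive-∷ʳD : ∀ {h c} → Positive h c 1 → FirstReturn h (c ++ D ∷ [])
positive-∷ʳD pos-nil      = ret-last
positive-∷ʳD (pos-up p)   = ret-up (positive-∷ʳD p)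
positive-∷ʳD (pos-down p) = ret-down (positive-∷ʳD p)

positive-peaks : ∀ h x → Positive (suc h) (peaks x) (suc h)
positive-peaks h zero    = pos-nil
positive-peaks h (suc x) = pos-up (pos-down (positive-peaks h x))

positive-towerBody : ∀ h r → Positive (suc h) (towerBody r) (suc h)

positive-tower : ∀ h r → Positive (suc h) (tower r) (suc h)
positive-tower h r = pos-up (positive-++ (positive-towerBody (suc h) r) (pos-down pos-nil))

positive-towerBody h []      = pos-nil
positive-towerBody h (x ∷ r) = positive-++ (positive-tower h r) (positive-peaks h x)

tower-firstReturn : ∀ r → FirstReturn 0 (tower r)
tower-firstReturn r = ret-up (positive-∷ʳD (positive-towerBody 0 r))

peaks-∷ʳD-injective : ∀ x y → peaks x ++ D ∷ [] ≡ peaks y ++ D ∷ [] → x ≡ y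
peaks-∷ʳD-injective zero    zero    _ = refl
peaks-∷ʳD-injective (suc x) (suc y) e = cong suc (peaks-∷ʳD-injective x y (∷-injectiveʳ (∷-injectiveʳ e)))

-- A first-return prefix is determined by the whole path, so the inner tower can be split off.
tower-∷-injective : ∀ x y r s → tower (x ∷ r) ≡ tower (y ∷ s) →
                    tower r ≡ tower s × peaks x ++ D ∷ [] ≡ peaks y ++ D ∷ []
tower-∷-injective x y r s e = ,-injective (begin
  (tower r , peaks x ++ D ∷ [])                ≡⟨ splitComp-firstReturn _ (tower-firstReturn r) ⟨
  splitComp 0 (tower r ++ peaks x ++ D ∷ [])   ≡⟨ cong (splitComp 0) (++-assoc (tower r) (peaks x) (D ∷ [])) ⟨
  splitComp 0 ((tower r ++ peaks x) ++ D ∷ []) ≡⟨ cong (splitComp 0) (∷-injectiveʳ e) ⟩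
  splitComp 0 ((tower s ++ peaks y) ++ D ∷ []) ≡⟨ cong (splitComp 0) (++-assoc (tower s) (peaks y) (D ∷ [])) ⟩
  splitComp 0 (tower s ++ peaks y ++ D ∷ [])   ≡⟨ splitComp-firstReturn _ (tower-firstReturn s) ⟩
  (tower s , peaks y ++ D ∷ [])                ∎)
  where open ≡-Reasoning

tower-injective : ∀ r s → tower r ≡ tower s → r ≡ s
tower-injective []      []      _ = refl
tower-injective (x ∷ r) (y ∷ s) e with tower-∷-injective x y r s e
... | tr≡ts , px≡py = cong₂ _∷_ (peaks-∷ʳD-injective x y px≡py) (tower-injective r s tr≡ts)

compsFuel-firstReturn : ∀ f {s xs} b → FirstReturn 0 (s ∷ xs) →
                        compsFuel (suc f) ((s ∷ xs) ++ b) ≡ (s ∷ xs) ∷ compsFuel f b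
compsFuel-firstReturn f b r rewrite splitComp-firstReturn b r = refl

compsFuel-[] : ∀ f → compsFuel f [] ≡ []
compsFuel-[] zero    = refl
compsFuel-[] (suc f) = refl

compsFuel-peaks : ∀ f z → z ≤ f → compsFuel f (peaks z) ≡ replicate z peak
compsFuel-peaks f       zero    _         = compsFuel-[] f
compsFuel-peaks (suc f) (suc z) (s≤s z≤f) =
  trans (compsFuel-firstReturn f (peaks z) (tower-firstReturn [])) (cong (peak ∷_) (compsFuel-peaks f z z≤f))

length-peaks : ∀ z → length (peaks z) ≡ z + z
length-peaks zero    = refl
length-peaks (suc z) = cong suc (trans (cong suc (length-peaks z)) (sym (+-suc z z)))

components-tower : ∀ r → components (tower r) ≡ tower r ∷ []
components-tower r = begin
  compsFuel (suc f) (tower r)       ≡⟨ cong (compsFuel (suc f)) (++-identityʳ (tower r)) ⟨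
  compsFuel (suc f) (tower r ++ []) ≡⟨ compsFuel-firstReturn f [] (tower-firstReturn r) ⟩
  tower r ∷ compsFuel f []          ≡⟨ cong (tower r ∷_) (compsFuel-[] f) ⟩
  tower r ∷ []                      ∎
  where
  open ≡-Reasoning
  f = length (towerBody r ++ D ∷ [])

components-tower-++-peaks : ∀ r z → components (tower r ++ peaks z) ≡ tower r ∷ replicate z peak
components-tower-++-peaks r z = trans (compsFuel-firstReturn f (peaks z) (tower-firstReturn r))
  (cong (tower r ∷_) (compsFuel-peaks f z z≤f))
  where
  f = length ((towerBody r ++ D ∷ []) ++ peaks z)
  z≤f : z ≤ f
  z≤f = begin
    z                                            ≤⟨ m≤m+n z z ⟩
    z + z                                        ≡⟨ length-peaks z ⟨
    length (peaks z)                             ≤⟨ m≤n+m _ (length (towerBody r ++ D ∷ [])) ⟩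
    length (towerBody r ++ D ∷ []) + length (peaks z) ≡⟨ length-++ (towerBody r ++ D ∷ []) ⟨
    length ((towerBody r ++ D ∷ []) ++ peaks z)  ∎
    where open ≤-Reasoning

FFuel-composite : ∀ f s xs c d cs → components (s ∷ xs) ≡ c ∷ d ∷ cs →
                  FFuel (suc f) (s ∷ xs) ≡ concatMap (FFuel f) (c ∷ d ∷ cs)
FFuel-composite f s xs c d cs e rewrite e = refl

FFuel-primitive-primQ : ∀ f s xs i Q → components (s ∷ xs) ≡ (s ∷ xs) ∷ [] →
  stripRevUD (reverse (body (s ∷ xs))) ≡ (i , reverse Q) → primCase Q ≡ primQ →
  FFuel (suc f) (s ∷ xs) ≡ replicate (suc i) U ++ FFuel f (body Q) ++ U ∷ D ∷ replicate (suc i) D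
FFuel-primitive-primQ f s xs i Q e₁ e₂ e₃ rewrite e₁ | e₂ | reverse-involutive Q | e₃ = refl

FFuel-primitive-nonPrimQ : ∀ f s xs i Q → components (s ∷ xs) ≡ (s ∷ xs) ∷ [] →
  stripRevUD (reverse (body (s ∷ xs))) ≡ (i , reverse Q) → primCase Q ≡ nonPrimQ →
  FFuel (suc f) (s ∷ xs) ≡ replicate (suc i) U ++ FFuel f Q ++ replicate (suc i) D
FFuel-primitive-nonPrimQ f s xs i Q e₁ e₂ e₃ rewrite e₁ | e₂ | reverse-involutive Q | e₃ = refl

FFuel-[] : ∀ f → FFuel f [] ≡ []
FFuel-[] zero    = refl
FFuel-[] (suc f) = refl

body-∷-∷ʳ : ∀ s xs t → body (s ∷ xs ++ t ∷ []) ≡ xs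
body-∷-∷ʳ s xs t = begin
  body (s ∷ xs ++ t ∷ [])   ≡⟨ body-reverse {xs ++ t ∷ []} (reverse-++ xs (t ∷ [])) ⟩
  reverse (reverse xs)      ≡⟨ reverse-involutive xs ⟩
  xs                        ∎
  where
  open ≡-Reasoning
  body-reverse : ∀ {ys t r} → reverse ys ≡ t ∷ r → body (s ∷ ys) ≡ reverse r
  body-reverse e rewrite e = refl

reversedPeaks : ℕ → Path
reversedPeaks zero    = []
reversedPeaks (suc x) = D ∷ U ∷ reversedPeaks x

reverse-peaks : ∀ x → reverse (peaks x) ≡ reversedPeaks x
reverse-peaks zero    = refl
reverse-peaks (suc x) = begin
  reverse (U ∷ D ∷ peaks x)             ≡⟨ reverse-++ (U ∷ D ∷ []) (peaks x) ⟩
  reverse (peaks x) ++ D ∷ U ∷ []       ≡⟨ cong (_++ D ∷ U ∷ []) (reverse-peaks x) ⟩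
  reversedPeaks x ++ D ∷ U ∷ []         ≡⟨ snoc x ⟩
  reversedPeaks (suc x)                 ∎
  where
  open ≡-Reasoning
  snoc : ∀ x → reversedPeaks x ++ D ∷ U ∷ [] ≡ D ∷ U ∷ reversedPeaks x
  snoc zero    = refl
  snoc (suc x) = cong (λ l → D ∷ U ∷ l) (snoc x)

stripRevUD-reversedPeaks : ∀ x s → stripRevUD s ≡ (0 , s) → stripRevUD (reversedPeaks x ++ s) ≡ (x , s)
stripRevUD-reversedPeaks zero    s e = e
stripRevUD-reversedPeaks (suc x) s e rewrite stripRevUD-reversedPeaks x s e = refl

reverse-tower : ∀ r → reverse (tower r) ≡ D ∷ reverse (towerBody r) ++ U ∷ []
reverse-tower r = trans (unfold-reverse U (towerBody r ++ D ∷ []))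
                        (cong (_++ U ∷ []) (reverse-++ (towerBody r) (D ∷ [])))

reverse-towerBody-∷ : ∀ y r → ∃[ t ] reverse (towerBody (y ∷ r)) ≡ D ∷ t
reverse-towerBody-∷ zero    r = _ , trans (reverse-++ (tower r) []) (reverse-tower r)
reverse-towerBody-∷ (suc y) r = _ , trans (reverse-++ (tower r) (peaks (suc y)))
                                          (cong (_++ reverse (tower r)) (reverse-peaks (suc y)))

reverse-tower-∷ : ∀ y r → ∃[ t ] reverse (tower (y ∷ r)) ≡ D ∷ D ∷ t
reverse-tower-∷ y r with reverse-towerBody-∷ y r
... | t , e = t ++ U ∷ [] , trans (reverse-tower (y ∷ r)) (cong (λ l → D ∷ l ++ U ∷ []) e)

stripRevUD-towerBody-∷∷ : ∀ x y r → stripRevUD (reverse (towerBody (x ∷ y ∷ r))) ≡ (x , reverse (tower (y ∷ r)))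
stripRevUD-towerBody-∷∷ x y r with reverse-tower-∷ y r
... | t , e = begin
  stripRevUD (reverse (tower (y ∷ r) ++ peaks x))
    ≡⟨ cong stripRevUD (reverse-++ (tower (y ∷ r)) (peaks x)) ⟩
  stripRevUD (reverse (peaks x) ++ reverse (tower (y ∷ r)))
    ≡⟨ cong (λ l → stripRevUD (l ++ reverse (tower (y ∷ r)))) (reverse-peaks x) ⟩
  stripRevUD (reversedPeaks x ++ reverse (tower (y ∷ r)))
    ≡⟨ stripRevUD-reversedPeaks x _ (trans (cong stripRevUD e) (cong (0 ,_) (sym e))) ⟩
  (x , reverse (tower (y ∷ r)))                             ∎
  where open ≡-Reasoning

stripRevUD-towerBody-[x] : ∀ x → stripRevUD (reverse (towerBody (x ∷ []))) ≡ (suc x , [])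
stripRevUD-towerBody-[x] x = begin
  stripRevUD (reverse (peaks (suc x)))       ≡⟨ cong stripRevUD (trans (reverse-peaks (suc x)) (sym (++-identityʳ _))) ⟩
  stripRevUD (reversedPeaks (suc x) ++ [])   ≡⟨ stripRevUD-reversedPeaks (suc x) [] refl ⟩
  (suc x , [])                               ∎
  where open ≡-Reasoning

primCase-tower : ∀ r → primCase (tower r) ≡ primQ
primCase-tower r rewrite components-tower r = refl

peaks-++-peak : ∀ y l → peaks y ++ U ∷ D ∷ l ≡ U ∷ D ∷ peaks y ++ l
peaks-++-peak zero    l = refl
peaks-++-peak (suc y) l = cong (λ z → U ∷ D ∷ z) (peaks-++-peak y l)

tower-replicate-0 : ∀ x s → tower (replicate x 0 ++ s) ≡ replicate x U ++ tower s ++ replicate x D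
tower-replicate-0 zero    s = sym (++-identityʳ (tower s))
tower-replicate-0 (suc x) s = begin
  U ∷ (tower (replicate x 0 ++ s) ++ []) ++ D ∷ []
    ≡⟨ cong (λ z → U ∷ z ++ D ∷ []) (++-identityʳ (tower (replicate x 0 ++ s))) ⟩
  U ∷ tower (replicate x 0 ++ s) ++ D ∷ []
    ≡⟨ cong (λ z → U ∷ z ++ D ∷ []) (tower-replicate-0 x s) ⟩
  U ∷ (replicate x U ++ tower s ++ replicate x D) ++ D ∷ []
    ≡⟨ cong (U ∷_) (++-assoc (replicate x U) _ _) ⟩
  U ∷ replicate x U ++ (tower s ++ replicate x D) ++ D ∷ []
    ≡⟨ cong (λ z → U ∷ replicate x U ++ z) (++-assoc (tower s) _ _) ⟩
  U ∷ replicate x U ++ tower s ++ replicate x D ++ D ∷ []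
    ≡⟨ cong (λ z → U ∷ replicate x U ++ tower s ++ z) (trans (replicate-++-∷ D x []) (cong (D ∷_) (++-identityʳ _))) ⟩
  U ∷ replicate x U ++ tower s ++ D ∷ replicate x D        ∎
  where open ≡-Reasoning

FFuel-tower-∷∷ : ∀ f x y r → FFuel f (tower r ++ peaks y) ≡ tower (next r) ++ peaks y →
                 FFuel (suc f) (tower (x ∷ y ∷ r)) ≡ tower (next (x ∷ y ∷ r))
FFuel-tower-∷∷ f x y r inner = begin
  FFuel (suc f) (tower (x ∷ y ∷ r))
    ≡⟨ FFuel-primitive-primQ f U _ x (tower (y ∷ r)) (components-tower (x ∷ y ∷ r)) strip (primCase-tower (y ∷ r)) ⟩
  U ∷ replicate x U ++ FFuel f (body (tower (y ∷ r))) ++ U ∷ D ∷ D ∷ replicate x D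
    ≡⟨ cong (λ z → U ∷ replicate x U ++ FFuel f z ++ U ∷ D ∷ D ∷ replicate x D) (body-∷-∷ʳ U (towerBody (y ∷ r)) D) ⟩
  U ∷ replicate x U ++ FFuel f (tower r ++ peaks y) ++ U ∷ D ∷ D ∷ replicate x D
    ≡⟨ cong (λ z → U ∷ replicate x U ++ z ++ U ∷ D ∷ D ∷ replicate x D) inner ⟩
  U ∷ replicate x U ++ (T ++ peaks y) ++ U ∷ D ∷ D ∷ replicate x D
    ≡⟨ cong (λ z → U ∷ replicate x U ++ z) regroup ⟩
  U ∷ replicate x U ++ ((T ++ U ∷ D ∷ peaks y) ++ D ∷ []) ++ replicate x D
    ≡⟨ replicate-++-∷ U x _ ⟨
  replicate x U ++ tower (suc y ∷ next r) ++ replicate x D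
    ≡⟨ tower-replicate-0 x (suc y ∷ next r) ⟨
  tower (replicate x 0 ++ suc y ∷ next r)
    ∎
  where
  open ≡-Reasoning
  T = tower (next r)
  strip : stripRevUD (reverse (body (tower (x ∷ y ∷ r)))) ≡ (x , reverse (tower (y ∷ r)))
  strip = trans (cong (λ z → stripRevUD (reverse z)) (body-∷-∷ʳ U (towerBody (x ∷ y ∷ r)) D))
                (stripRevUD-towerBody-∷∷ x y r)
  regroup : (T ++ peaks y) ++ U ∷ D ∷ D ∷ replicate x D ≡ ((T ++ U ∷ D ∷ peaks y) ++ D ∷ []) ++ replicate x D
  regroup = begin
    (T ++ peaks y) ++ U ∷ D ∷ D ∷ replicate x D     ≡⟨ ++-assoc T (peaks y) _ ⟩
    T ++ peaks y ++ U ∷ D ∷ D ∷ replicate x D       ≡⟨ cong (T ++_) (peaks-++-peak y _) ⟩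
    T ++ U ∷ D ∷ peaks y ++ D ∷ replicate x D       ≡⟨ ++-assoc T (U ∷ D ∷ peaks y) _ ⟨
    (T ++ U ∷ D ∷ peaks y) ++ D ∷ replicate x D     ≡⟨ ++-assoc (T ++ U ∷ D ∷ peaks y) (D ∷ []) _ ⟨
    ((T ++ U ∷ D ∷ peaks y) ++ D ∷ []) ++ replicate x D ∎

length-tower-∷ : ∀ x r → 2 + length (tower r) ≤ length (tower (x ∷ r))
length-tower-∷ x r = s≤s (begin
  suc (length (tower r))                          ≡⟨ +-comm 1 (length (tower r)) ⟩
  length (tower r) + 1                            ≤⟨ +-monoˡ-≤ 1 (m≤m+n (length (tower r)) (length (peaks x))) ⟩
  length (tower r) + length (peaks x) + 1         ≡⟨ cong (_+ 1) (length-++ (tower r)) ⟨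
  length (tower r ++ peaks x) + 1                 ≡⟨ length-++ (tower r ++ peaks x) ⟨
  length ((tower r ++ peaks x) ++ D ∷ [])         ∎)
  where open ≤-Reasoning

length-tower-∷∷ : ∀ x y r → 4 + length (tower r) ≤ length (tower (x ∷ y ∷ r))
length-tower-∷∷ x y r = ≤-trans (s≤s (s≤s (length-tower-∷ y r))) (length-tower-∷ x (y ∷ r))

2≤length-tower : ∀ r → 2 ≤ length (tower r)
2≤length-tower r = s≤s (subst (1 ≤_) (sym (length-++ (towerBody r) {D ∷ []})) (m≤n+m 1 (length (towerBody r))))

6≤length-tower-∷∷ : ∀ x y r → 6 ≤ length (tower (x ∷ y ∷ r))
6≤length-tower-∷∷ x y r = ≤-trans (+-monoʳ-≤ 4 (2≤length-tower r)) (length-tower-∷∷ x y r)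

concatMap-FFuel-peaks : ∀ f z → 2 ≤ f → concatMap (FFuel f) (replicate z peak) ≡ peaks z
concatMap-FFuel-peaks f             zero    _ = refl
concatMap-FFuel-peaks (suc zero)    (suc z) (s≤s ())
concatMap-FFuel-peaks (suc (suc f)) (suc z) _ = cong (λ l → U ∷ D ∷ l) (concatMap-FFuel-peaks (suc (suc f)) z (s≤s (s≤s z≤n)))

FFuel-tower-[x] : ∀ f x → FFuel (suc f) (tower (x ∷ [])) ≡ tower (next (x ∷ []))
FFuel-tower-[x] f x = begin
  FFuel (suc f) (tower (x ∷ []))
    ≡⟨ FFuel-primitive-nonPrimQ f U _ (suc x) [] (components-tower (x ∷ [])) strip refl ⟩
  replicate (suc (suc x)) U ++ FFuel f [] ++ replicate (suc (suc x)) D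
    ≡⟨ cong (λ z → replicate (suc (suc x)) U ++ z ++ replicate (suc (suc x)) D) (FFuel-[] f) ⟩
  U ∷ replicate (suc x) U ++ D ∷ replicate (suc x) D
    ≡⟨ replicate-++-∷ U (suc x) _ ⟨
  replicate (suc x) U ++ tower [] ++ replicate (suc x) D
    ≡⟨ tower-replicate-0 (suc x) [] ⟨
  tower (replicate (suc x) 0 ++ [])
    ≡⟨ cong tower (++-identityʳ (replicate (suc x) 0)) ⟩
  tower (replicate (suc x) 0)
    ∎
  where
  open ≡-Reasoning
  strip : stripRevUD (reverse (body (tower (x ∷ [])))) ≡ (suc x , [])
  strip = trans (cong (λ z → stripRevUD (reverse z)) (body-∷-∷ʳ U (towerBody (x ∷ [])) D))
                (stripRevUD-towerBody-[x] x)

FFuel-tower : ∀ f r → length (tower r) ≤ f → FFuel f (tower r) ≡ tower (next r)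
FFuel-tower (suc zero)    []             (s≤s ())
FFuel-tower (suc (suc f)) []             _    = refl
FFuel-tower (suc f)       (x ∷ [])       _    = FFuel-tower-[x] f x
FFuel-tower (suc f)       (x ∷ zero ∷ r) len≤ = FFuel-tower-∷∷ f x zero r (begin
  FFuel f (tower r ++ [])  ≡⟨ cong (FFuel f) (++-identityʳ (tower r)) ⟩
  FFuel f (tower r)        ≡⟨ FFuel-tower f r (≤-trans (m≤n+m _ 3) (≤-pred (≤-trans (length-tower-∷∷ x zero r) len≤))) ⟩
  tower (next r)           ≡⟨ ++-identityʳ (tower (next r)) ⟨
  tower (next r) ++ []     ∎)
  where open ≡-Reasoning
FFuel-tower (suc zero) (x ∷ suc y ∷ r) len≤ = contradiction (≤-trans (6≤length-tower-∷∷ x (suc y) r) len≤) λ { (s≤s ()) }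
FFuel-tower (suc (suc f)) (x ∷ suc y ∷ r) len≤ = FFuel-tower-∷∷ (suc f) x (suc y) r (begin
  FFuel (suc f) (tower r ++ peaks (suc y))
    ≡⟨ FFuel-composite f U ((towerBody r ++ D ∷ []) ++ peaks (suc y)) (tower r) peak (replicate y peak)
                       (components-tower-++-peaks r (suc y)) ⟩
  FFuel f (tower r) ++ concatMap (FFuel f) (replicate (suc y) peak)
    ≡⟨ cong₂ _++_ (FFuel-tower f r (≤-trans (m≤n+m _ 2) 2+len≤f)) (concatMap-FFuel-peaks f (suc y) 2≤f) ⟩
  tower (next r) ++ peaks (suc y)
    ∎)
  where
  open ≡-Reasoning
  2+len≤f : 2 + length (tower r) ≤ f
  2+len≤f = ≤-pred (≤-pred (≤-trans (length-tower-∷∷ x (suc y) r) len≤))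
  2≤f : 2 ≤ f
  2≤f = ≤-trans (m≤m+n 2 (length (tower r))) 2+len≤f

F^-tower : ∀ t r → F^ t (tower r) ≡ tower (next^ t r)
F^-tower zero    r = refl
F^-tower (suc t) r = trans (cong F (F^-tower t r)) (FFuel-tower _ (next^ t r) ≤-refl)

All-vertexHeights-++ : ∀ {P : ℕ → Set} {h a h′ b} → Positive h a h′ →
  All P (vertexHeights h a) → All P (vertexHeights h′ b) → All P (vertexHeights h (a ++ b))
All-vertexHeights-++ pos-nil      (_ ∷ []) q = q
All-vertexHeights-++ (pos-up p)   (x ∷ xs) q = x ∷ All-vertexHeights-++ p xs q
All-vertexHeights-++ (pos-down p) (x ∷ xs) q = x ∷ All-vertexHeights-++ p xs q

Any-vertexHeights-++ˡ : ∀ {P : ℕ → Set} h a b → Any P (vertexHeights h a) → Any P (vertexHeights h (a ++ b))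
Any-vertexHeights-++ˡ h []      []      p         = p
Any-vertexHeights-++ˡ h []      (U ∷ b) (here p)  = here p
Any-vertexHeights-++ˡ h []      (D ∷ b) (here p)  = here p
Any-vertexHeights-++ˡ h (U ∷ a) b       (here p)  = here p
Any-vertexHeights-++ˡ h (D ∷ a) b       (here p)  = here p
Any-vertexHeights-++ˡ h (U ∷ a) b       (there p) = there (Any-vertexHeights-++ˡ (suc h) a b p)
Any-vertexHeights-++ˡ h (D ∷ a) b       (there p) = there (Any-vertexHeights-++ˡ (h ∸ 1) a b p)

vertexHeights-peaks-≤ : ∀ M h x → suc h ≤ M → All (_≤ M) (vertexHeights h (peaks x))
vertexHeights-peaks-≤ M h zero    h<M = <⇒≤ h<M ∷ []
vertexHeights-peaks-≤ M h (suc x) h<M = <⇒≤ h<M ∷ h<M ∷ vertexHeights-peaks-≤ M h x h<M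

vertexHeights-towerBody-≤ : ∀ M h r → suc h + length r ≤ M → All (_≤ M) (vertexHeights (suc h) (towerBody r))

vertexHeights-tower-≤ : ∀ M h r → h + suc (length r) ≤ M → All (_≤ M) (vertexHeights h (tower r))
vertexHeights-tower-≤ M h r bound =
  ≤-trans (m≤m+n h _) bound ∷
  All-vertexHeights-++ (positive-towerBody h r)
    (vertexHeights-towerBody-≤ M h r (≤-trans (≤-reflexive (sym (+-suc h (length r)))) bound))
    (≤-trans (≤-trans (≤-reflexive (+-comm 1 h)) (+-monoʳ-≤ h (s≤s z≤n))) bound ∷ ≤-trans (m≤m+n h _) bound ∷ [])

vertexHeights-towerBody-≤ M h []      bound = ≤-trans (≤-reflexive (sym (+-identityʳ (suc h)))) bound ∷ []
vertexHeights-towerBody-≤ M h (x ∷ r) bound =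
  All-vertexHeights-++ (positive-tower h r) (vertexHeights-tower-≤ M (suc h) r bound)
    (vertexHeights-peaks-≤ M (suc h) x (≤-trans (s≤s (m≤m+n (suc h) (length r)))
      (≤-trans (≤-reflexive (sym (+-suc (suc h) (length r)))) bound)))

vertexHeights-tower-top : ∀ h r → Any (h + suc (length r) ≡_) (vertexHeights h (tower r))
vertexHeights-tower-top h []      = there (here (+-comm h 1))
vertexHeights-tower-top h (x ∷ r) = there (Any-vertexHeights-++ˡ (suc h) (tower r ++ peaks x) (D ∷ [])
  (Any-vertexHeights-++ˡ (suc h) (tower r) (peaks x)
    (subst (λ M → Any (M ≡_) (vertexHeights (suc h) (tower r))) (sym (+-suc h (suc (length r))))
      (vertexHeights-tower-top (suc h) r))))

maxList-≤ : ∀ M l → All (_≤ M) l → maxList l ≤ M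
maxList-≤ M []      []       = z≤n
maxList-≤ M (x ∷ l) (p ∷ ps) = ⊔-lub p (maxList-≤ M l ps)

maxList-≡ : ∀ M l → All (_≤ M) l → Any (M ≡_) l → maxList l ≡ M
maxList-≡ M (x ∷ l) (p ∷ ps) (here M≡x) = trans (m≥n⇒m⊔n≡m (subst (maxList l ≤_) M≡x (maxList-≤ M l ps))) (sym M≡x)
maxList-≡ M (x ∷ l) (p ∷ ps) (there i)  = trans (cong (x ⊔_) (maxList-≡ M l ps i)) (m≤n⇒m⊔n≡n p)

height-tower : ∀ r → height (tower r) ≡ suc (length r)
height-tower r = maxList-≡ (suc (length r)) _ (vertexHeights-tower-≤ (suc (length r)) 0 r ≤-refl) (vertexHeights-tower-top 0 r)

length-composition : ∀ p → length (composition p) ≡ height p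
length-composition p = trans (length-map _ (upTo (height p))) (length-upTo (height p))

size-++ : ∀ a b → size (a ++ b) ≡ size a + size b
size-++ []      b = refl
size-++ (U ∷ a) b = cong suc (size-++ a b)
size-++ (D ∷ a) b = size-++ a b

size-peaks : ∀ x → size (peaks x) ≡ x
size-peaks zero    = refl
size-peaks (suc x) = cong suc (size-peaks x)

size-towerBody : ∀ r → size (towerBody r) ≡ length r + sum r

size-tower : ∀ r → size (tower r) ≡ suc (length r + sum r)
size-tower r = cong suc (trans (size-++ (towerBody r) (D ∷ [])) (trans (+-identityʳ _) (size-towerBody r)))

size-towerBody []      = refl
size-towerBody (x ∷ r) = begin
  size (tower r ++ peaks x)          ≡⟨ size-++ (tower r) (peaks x) ⟩
  size (tower r) + size (peaks x)    ≡⟨ cong₂ _+_ (size-tower r) (size-peaks x) ⟩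
  suc (length r + sum r + x)         ≡⟨ cong suc (+-assoc (length r) (sum r) x) ⟩
  suc (length r + (sum r + x))       ≡⟨ cong (λ z → suc (length r + z)) (+-comm (sum r) x) ⟩
  suc (length r + (x + sum r))       ∎
  where open ≡-Reasoning

firstReturn⇒DyckFrom : ∀ {h c} → FirstReturn h c → DyckFrom h c
firstReturn⇒DyckFrom (ret-up r)   = up (firstReturn⇒DyckFrom r)
firstReturn⇒DyckFrom ret-last     = down done
firstReturn⇒DyckFrom (ret-down r) = down (firstReturn⇒DyckFrom r)

DyckFrom-suc-nonempty : ∀ {h p} → DyckFrom (suc h) p → ¬ p ≡ []
DyckFrom-suc-nonempty () refl

firstReturn-prefix : ∀ {h p} → DyckFrom h p → ¬ p ≡ [] → ∃[ c ] ∃[ d ] (p ≡ c ++ d × FirstReturn h c × Dyck d)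
firstReturn-prefix done ne = contradiction refl ne
firstReturn-prefix (up dp) _ with firstReturn-prefix dp (DyckFrom-suc-nonempty dp)
... | c , d , refl , r , dd = U ∷ c , d , refl , ret-up r , dd
firstReturn-prefix (down {zero} {xs} dp) _ = D ∷ [] , xs , refl , ret-last , dp
firstReturn-prefix (down {suc h} dp) _ with firstReturn-prefix dp (DyckFrom-suc-nonempty dp)
... | c , d , refl , r , dd = D ∷ c , d , refl , ret-down r , dd

primitive⇒firstReturn : ∀ p → Dyck p → Primitive p → FirstReturn 0 p
primitive⇒firstReturn p dp (p≢[] , no-proper-prefix) with firstReturn-prefix dp p≢[]
... | c , []    , refl , r , _ = subst (FirstReturn 0) (sym (++-identityʳ c)) r
... | c , s ∷ d , refl , r , _ = contradiction (firstReturn⇒DyckFrom r) (no-proper-prefix c (s ∷ d) refl (c≢[] r) λ ())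
  where
  c≢[] : ∀ {c} → FirstReturn 0 c → ¬ c ≡ []
  c≢[] (ret-up _) ()

avoidsDUU-++ʳ : ∀ a {b} → AvoidsDUU (a ++ b) → AvoidsDUU b
avoidsDUU-++ʳ []      av = av
avoidsDUU-++ʳ (s ∷ a) av = avoidsDUU-++ʳ a λ (a′ , b′ , e) → av (s ∷ a′ , b′ , cong (s ∷_) e)

leading-Us : ∀ {h xs} → FirstReturn h xs → ∃[ j ] ∃[ q ] (xs ≡ replicate j U ++ D ∷ q × FirstReturn (j + h) (D ∷ q))
leading-Us (ret-up r) with leading-Us r
... | j , q , refl , r′ = suc j , q , refl , subst (λ k → FirstReturn k (D ∷ q)) (+-suc j _) r′
leading-Us ret-last     = 0 , [] , refl , ret-last
leading-Us (ret-down r) = 0 , _ , refl , ret-down r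

-- After a downstep, avoiding DUU forces the path to continue by isolated peaks UD before the next D.
peaks-prefix : ∀ l q → FirstReturn (suc l) q → AvoidsDUU (D ∷ q) →
               ∃[ x ] ∃[ q′ ] (q ≡ peaks x ++ D ∷ q′ × FirstReturn (suc l) (D ∷ q′))
peaks-prefix l (D ∷ q′)     r                   _  = 0 , q′ , refl , r
peaks-prefix l (U ∷ U ∷ q)  _                   av = contradiction ([] , q , refl) av
peaks-prefix l (U ∷ [])     (ret-up ())          _
peaks-prefix l (U ∷ D ∷ q)  (ret-up (ret-down r)) av with peaks-prefix l q r (avoidsDUU-++ʳ (D ∷ U ∷ []) av)
... | x , q′ , refl , r′ = suc x , q′ , refl , r′

tower-parse : ∀ k r q → FirstReturn (suc k) (D ∷ q) → AvoidsDUU (D ∷ q) →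
              ∃[ s ] replicate k U ++ tower r ++ q ≡ tower s
tower-parse zero    r [] ret-last       _  = r , ++-identityʳ (tower r)
tower-parse (suc k) r q  (ret-down ret) av with peaks-prefix k q ret av
... | x , q′ , refl , ret′ with tower-parse k (x ∷ r) q′ ret′ (avoidsDUU-++ʳ (D ∷ peaks x) av)
... | s , e = s , (begin
  U ∷ replicate k U ++ tower r ++ peaks x ++ D ∷ q′   ≡⟨ replicate-++-∷ U k _ ⟨
  replicate k U ++ U ∷ tower r ++ peaks x ++ D ∷ q′   ≡⟨ cong (λ z → replicate k U ++ U ∷ z) (regroup (tower r) (peaks x)) ⟩
  replicate k U ++ tower (x ∷ r) ++ q′                ≡⟨ e ⟩
  tower s                                             ∎)
  where
  open ≡-Reasoning
  regroup : ∀ a b → a ++ b ++ D ∷ q′ ≡ ((a ++ b) ++ D ∷ []) ++ q′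
  regroup a b = trans (sym (++-assoc a b (D ∷ q′))) (sym (++-assoc (a ++ b) (D ∷ []) q′))

primitive-avoidsDUU⇒tower : ∀ p → Dyck p → Primitive p → AvoidsDUU p → ∃[ r ] p ≡ tower r
primitive-avoidsDUU⇒tower p dp prim av with primitive⇒firstReturn p dp prim
... | ret-up r with leading-Us r
...   | j , q , refl , r′ with tower-parse j [] q (subst (λ k → FirstReturn k (D ∷ q)) (+-comm j 1) r′)
                                            (avoidsDUU-++ʳ (U ∷ replicate j U) av)
...     | s , e = s , trans (sym (replicate-++-∷ U j (D ∷ q))) e

-- Orbits

-- n = m + 2 is the size of tower r.
module TowerOrbit (m : ℕ) (r : List ℕ) (length-word≡ : length (word r) ≡ suc m) where

  private
    v : Series
    v = series (word r)

    L : ℕ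
    L = 2 ^ binaryDigits m

    m<length : m < length (word r)
    m<length = subst (m <_) (sym length-word≡) ≤-refl

  head≡1ℙ : v 0 ≡ 1ℙ
  head≡1ℙ = series-word-head r (≤-<-trans z≤n m<length)

  next^-fixed : ∀ t → (∀ i → i ≤ m → prefixSum^ t v i ≡ v i) → next^ t r ≡ r
  next^-fixed t agree = word-injective _ r (series-injective _ _ (length-word-next^ t r) λ i i<l →
    let i<l′ = subst (i <_) (length-word-next^ t r) i<l in
    trans (series-word-next^ t r i i<l′) (agree i (≤-pred (subst (i <_) length-word≡ i<l′))))

  next^-agrees : ∀ t → next^ t r ≡ r → ∀ i → i ≤ m → prefixSum^ t v i ≡ v i
  next^-agrees t e i i≤m = trans (sym (series-word-next^ t r i (≤-<-trans i≤m m<length))) (cong (λ q → series (word q) i) e)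

  tower-period : F^ L (tower r) ≡ tower r
  tower-period = trans (F^-tower L r) (cong tower (next^-fixed L (prefixSum^-period m v)))

  tower-aperiodic : ∀ t → 1 ≤ t → t < L → ¬ F^ t (tower r) ≡ tower r
  tower-aperiodic t 1≤t t<L e with prefixSum^-aperiodic m v head≡1ℙ t 1≤t t<L
  ... | i , i≤m , differs = differs (next^-agrees t (tower-injective _ r (trans (sym (F^-tower t r)) e)) i i≤m)

  -- The height of tower q is 1 + length q, and length q counts the 1s of word q, whose sum is
  -- the last letter of word (next q).
  compositionParity-F^ : ∀ T → ℕ.parity (parity (composition (F^ T (tower r)))) ≡ 1ℙ ⊕ prefixSum^ (suc T) v m
  compositionParity-F^ T = begin
    ℕ.parity (length (composition (F^ T (tower r))) % 2)
      ≡⟨ parity-%2 (length (composition (F^ T (tower r)))) ⟩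
    ℕ.parity (length (composition (F^ T (tower r))))
      ≡⟨ cong (λ p → ℕ.parity (length (composition p))) (F^-tower T r) ⟩
    ℕ.parity (length (composition (tower q)))
      ≡⟨ cong ℕ.parity (trans (length-composition (tower q)) (height-tower q)) ⟩
    ℕ.parity (1 + length q)
      ≡⟨ ℙ.+-homo-+ 1 (length q) ⟩
    1ℙ ⊕ ℕ.parity (length q)
      ≡⟨ cong (1ℙ ⊕_) (sumℙ-word q) ⟨
    1ℙ ⊕ sumℙ (word q)
      ≡⟨ cong (1ℙ ⊕_) (series-prefixSums-last 0ℙ (word q) m (trans (length-word-next^ T r) length-word≡)) ⟨
    1ℙ ⊕ series (prefixSums 0ℙ (word q)) m
      ≡⟨ cong (λ l → 1ℙ ⊕ series l m) (word-next q) ⟨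
    1ℙ ⊕ series (word (next q)) m
      ≡⟨ cong (1ℙ ⊕_) (series-word-next^ (suc T) r m m<length) ⟩
    1ℙ ⊕ prefixSum^ (suc T) v m                              ∎
    where
    open ≡-Reasoning
    q = next^ T r

  orbitParitySum-parity : ∀ T → ℕ.parity (orbitParitySum T (tower r)) ≡ ℕ.parity T ⊕ sumOfIterates (suc T) v m ⊕ v m
  orbitParitySum-parity zero    = sym (ℙ.p+p≡0ℙ (v m))
  orbitParitySum-parity (suc T) = begin
    ℕ.parity (orbitParitySum T (tower r) + parity (composition (F^ T (tower r))))
      ≡⟨ ℙ.+-homo-+ (orbitParitySum T (tower r)) _ ⟩
    ℕ.parity (orbitParitySum T (tower r)) ⊕ ℕ.parity (parity (composition (F^ T (tower r))))
      ≡⟨ cong₂ _⊕_ (orbitParitySum-parity T) (compositionParity-F^ T) ⟩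
    ℕ.parity T ⊕ S ⊕ v m ⊕ (1ℙ ⊕ P)
      ≡⟨ xy∙z≈xz∙y (ℕ.parity T ⊕ S) (v m) (1ℙ ⊕ P) ⟩
    ℕ.parity T ⊕ S ⊕ (1ℙ ⊕ P) ⊕ v m
      ≡⟨ cong (_⊕ v m) (interchange (ℕ.parity T) S 1ℙ P) ⟩
    ℕ.parity T ⊕ 1ℙ ⊕ (S ⊕ P) ⊕ v m
      ≡⟨ cong (λ p → p ⊕ (S ⊕ P) ⊕ v m) (trans (ℙ.+-comm (ℕ.parity T) 1ℙ) (sym (ℙ.+-homo-+ 1 T))) ⟩
    ℕ.parity (suc T) ⊕ (S ⊕ P) ⊕ v m
      ∎
    where
    open ≡-Reasoning
    S = sumOfIterates (suc T) v m
    P = prefixSum^ (suc T) v m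

  parity-orbitParitySum-period : ℕ.parity (orbitParitySum L (tower r)) ≡ ℕ.parity L ⊕ sumOfIterates L v m
  parity-orbitParitySum-period = begin
    ℕ.parity (orbitParitySum L (tower r))
      ≡⟨ orbitParitySum-parity L ⟩
    ℕ.parity L ⊕ (sumOfIterates L v m ⊕ prefixSum^ L v m) ⊕ v m
      ≡⟨ cong (λ p → ℕ.parity L ⊕ (sumOfIterates L v m ⊕ p) ⊕ v m) (prefixSum^-period m v m ≤-refl) ⟩
    ℕ.parity L ⊕ (sumOfIterates L v m ⊕ v m) ⊕ v m
      ≡⟨ ℙ.+-assoc (ℕ.parity L) _ (v m) ⟩
    ℕ.parity L ⊕ (sumOfIterates L v m ⊕ v m ⊕ v m)
      ≡⟨ cong (ℕ.parity L ⊕_) (x⊕y⊕y≡x _ (v m)) ⟩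
    ℕ.parity L ⊕ sumOfIterates L v m
      ∎
    where open ≡-Reasoning

-- The value at 0 is junk: sizes of primitive paths are positive.
orbitParity : ℕ → Parity
orbitParity (suc (suc (suc m))) with suc (suc m) ≟ 2 ^ binaryDigits (suc m)
... | yes _ = 1ℙ
... | no  _ = 0ℙ
orbitParity (suc (suc zero)) = 0ℙ
orbitParity _                = 1ℙ

parity-orbitParitySum-tower : ∀ m r → length (word r) ≡ suc m →
  ℕ.parity (orbitParitySum (orbitLength (suc (suc m))) (tower r)) ≡ orbitParity (suc (suc m))
parity-orbitParitySum-tower zero r len = trans parity-orbitParitySum-period (cong (1ℙ ⊕_) head≡1ℙ)
  where open TowerOrbit zero r len
parity-orbitParitySum-tower (suc m) r len = begin
  ℕ.parity (orbitParitySum L (tower r))   ≡⟨ parity-orbitParitySum-period ⟩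
  ℕ.parity L ⊕ sumOfIterates L v (suc m)  ≡⟨ cong (_⊕ sumOfIterates L v (suc m)) L-even ⟩
  sumOfIterates L v (suc m)               ≡⟨ coefficient ⟩
  orbitParity (suc (suc (suc m)))         ∎
  where
  open ≡-Reasoning
  open TowerOrbit (suc m) r len
  v = series (word r)
  L = 2 ^ binaryDigits (suc m)
  open SumOfIterates (m^n>0 2 (binaryDigits (suc m))) (prefixSum^-2^ (binaryDigits (suc m)) v)
  L-even : ℕ.parity L ≡ 0ℙ
  L-even with binaryDigits-spec (suc m) (s≤s z≤n)
  ... | b , bits≡ , _ = trans (cong (λ k → ℕ.parity (2 ^ k)) bits≡) (parity-2^suc b)
  coefficient : sumOfIterates L v (suc m) ≡ orbitParity (suc (suc (suc m)))
  coefficient with suc (suc m) ≟ L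
  ... | yes 2+m≡L = trans (last-coefficient (suc m) 2+m≡L) head≡1ℙ
  ... | no  2+m≢L = earlier-coefficient (suc m) (≤∧≢⇒< (<2^binaryDigits (suc m)) 2+m≢L)

orbitParity≡1ℙ⇔ : ∀ n → 1 ≤ n → orbitParity n ≡ 1ℙ ⇔ (n ≡ 1 ⊎ ∃[ j ] (1 ≤ j × n ≡ 2 ^ j + 1))
orbitParity≡1ℙ⇔ (suc zero)       _ = mk⇔ (λ _ → inj₁ refl) (λ _ → refl)
orbitParity≡1ℙ⇔ (suc (suc zero)) _ = mk⇔ (λ ()) λ
  { (inj₂ (suc j , _ , 2≡2^j+1)) → contradiction (suc-injective (trans 2≡2^j+1 (+-comm (2 ^ suc j) 1))) (<⇒≢ (2^suc>1 j)) }
  where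
  2^suc>1 : ∀ j → 1 < 2 ^ suc j
  2^suc>1 j = ^-monoʳ-< 2 (s≤s (s≤s z≤n)) {0} {suc j} (s≤s z≤n)
orbitParity≡1ℙ⇔ (suc (suc (suc m))) _ with suc (suc m) ≟ 2 ^ binaryDigits (suc m)
... | yes 2+m≡L = mk⇔ (λ _ → inj₂ (binaryDigits (suc m) , 1≤bits , trans (cong suc 2+m≡L) (+-comm 1 _))) (λ _ → refl)
  where
  1≤bits : 1 ≤ binaryDigits (suc m)
  1≤bits with binaryDigits-spec (suc m) (s≤s z≤n)
  ... | b , bits≡ , _ = subst (1 ≤_) (sym bits≡) (s≤s z≤n)
... | no  2+m≢L = mk⇔ (λ ()) λ { (inj₂ (j , _ , e)) → contradiction (not-power j e) 2+m≢L }
  where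
  not-power : ∀ j → suc (suc (suc m)) ≡ 2 ^ j + 1 → suc (suc m) ≡ 2 ^ binaryDigits (suc m)
  not-power j e = subst (λ k → suc (suc m) ≡ 2 ^ k) (sym (binaryDigits-pred-2^ (suc m) j (s≤s z≤n) 2+m≡2^j)) 2+m≡2^j
    where
    2+m≡2^j : suc (suc m) ≡ 2 ^ j
    2+m≡2^j = suc-injective (trans e (+-comm (2 ^ j) 1))

record OrbitStructure (n : ℕ) (p : Path) : Set where
  field
    returns : F^ (orbitLength n) p ≡ p
    minimal : ∀ t → 1 ≤ t → t < orbitLength n → ¬ F^ t p ≡ p
    parity≡ : ℕ.parity (orbitParitySum (orbitLength n) p) ≡ orbitParity n

orbitStructure-tower : ∀ n r → size (tower r) ≡ n → OrbitStructure n (tower r)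
orbitStructure-tower (suc zero)    []    _ = record
  { returns = refl ; minimal = λ { _ (s≤s _) (s≤s ()) } ; parity≡ = refl }
orbitStructure-tower (suc (suc m)) r size≡ = record
  { returns = tower-period ; minimal = tower-aperiodic ; parity≡ = parity-orbitParitySum-tower m r length-word≡ }
  where
  length-word≡ : length (word r) ≡ suc m
  length-word≡ = trans (length-word r) (suc-injective (trans (sym (size-tower r)) size≡))
  open TowerOrbit m r length-word≡

orbitStructure : ∀ n p → Dyck p → Primitive p → AvoidsDUU p → size p ≡ n → OrbitStructure n p
orbitStructure n p dp prim av size≡ with primitive-avoidsDUU⇒tower p dp prim av
... | r , refl = orbitStructure-tower n r size≡

orbitLength-2^ : ∀ n → ∃[ k ] orbitLength n ≡ 2 ^ k
orbitLength-2^ zero          = 0 , refl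
orbitLength-2^ (suc zero)    = 0 , refl
orbitLength-2^ (suc (suc m)) = binaryDigits m , refl

minimal-return-unique : ∀ {p L L′} → F^ L p ≡ p → (∀ t → 1 ≤ t → t < L → ¬ F^ t p ≡ p) →
  1 ≤ L → 1 ≤ L′ → F^ L′ p ≡ p → (∀ t → 1 ≤ t → t < L′ → ¬ F^ t p ≡ p) → L′ ≡ L
minimal-return-unique {L = L} {L′} ret min 1≤L 1≤L′ ret′ min′ with <-cmp L′ L
... | tri< L′<L _ _ = contradiction ret′ (min L′ 1≤L′ L′<L)
... | tri≈ _ L′≡L _ = L′≡L
... | tri> _ _ L<L′ = contradiction ret (min′ L 1≤L L<L′)

1≤orbitLength : ∀ n → 1 ≤ orbitLength n
1≤orbitLength n = subst (1 ≤_) (sym (proj₂ (orbitLength-2^ n))) (m^n>0 2 (proj₁ (orbitLength-2^ n)))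

orbitParitySum-%2 : ∀ {n p} → OrbitStructure n p → orbitParitySum (orbitLength n) p % 2 ≡ toℕ (orbitParity n)
orbitParitySum-%2 {n} {p} o = trans (%2≡toℕ∘parity (orbitParitySum (orbitLength n) p)) (cong toℕ (OrbitStructure.parity≡ o))

orbitParitySum-%2≡1⇔ : ∀ {n p} → 1 ≤ n → OrbitStructure n p →
  orbitParitySum (orbitLength n) p % 2 ≡ 1 ⇔ (n ≡ 1 ⊎ ∃[ j ] (1 ≤ j × n ≡ 2 ^ j + 1))
orbitParitySum-%2≡1⇔ {n} {p} 1≤n o = orbitParity≡1ℙ⇔ n 1≤n ⇔-∘
  subst (λ q → orbitParitySum (orbitLength n) p % 2 ≡ 1 ⇔ q ≡ 1ℙ) (OrbitStructure.parity≡ o)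
    (%2≡1⇔parity≡1ℙ (orbitParitySum (orbitLength n) p))

theorem6 : (n : ℕ) → 1 ≤ n →
    -- (i) all orbits have the same length, a power of 2
    (∃[ L ] ∃[ k ] (L ≡ 2 ^ k ×
      (∀ (p : Path) → Dyck p → Primitive p → AvoidsDUU p → size p ≡ n →
        F^ L p ≡ p × (∀ m → 1 ≤ m → m < L → ¬ (F^ m p ≡ p))))) ×
    -- (ii) all orbits have the same parity
    (∃[ e ] (∀ (p : Path) → Dyck p → Primitive p → AvoidsDUU p → size p ≡ n →
        ∀ L → 1 ≤ L → F^ L p ≡ p → (∀ m → 1 ≤ m → m < L → ¬ (F^ m p ≡ p)) →
        orbitParitySum L p % 2 ≡ e)) ×
    -- (iii) the common length and parity
    (∀ (p : Path) → Dyck p → Primitive p → AvoidsDUU p → size p ≡ n →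
        F^ (orbitLength n) p ≡ p ×
        (∀ m → 1 ≤ m → m < orbitLength n → ¬ (F^ m p ≡ p)) ×
        ((orbitParitySum (orbitLength n) p % 2 ≡ 1) ⇔
          (n ≡ 1 ⊎ ∃[ j ] (1 ≤ j × n ≡ 2 ^ j + 1))))
theorem6 n 1≤n =
  (orbitLength n , proj₁ (orbitLength-2^ n) , proj₂ (orbitLength-2^ n) ,
    λ p dp prim av size≡ → let o = orbitStructure n p dp prim av size≡ in returns o , minimal o) ,
  (toℕ (orbitParity n) ,
    λ p dp prim av size≡ L 1≤L ret min → let o = orbitStructure n p dp prim av size≡ in
      subst (λ L → orbitParitySum L p % 2 ≡ toℕ (orbitParity n))
            (sym (minimal-return-unique (returns o) (minimal o) (1≤orbitLength n) 1≤L ret min))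
            (orbitParitySum-%2 o)) ,
  λ p dp prim av size≡ → let o = orbitStructure n p dp prim av size≡ in
    returns o , minimal o , orbitParitySum-%2≡1⇔ 1≤n o
  where open OrbitStructure
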